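{- Let $S=(1,s_2,\ldots)$ be a packing sequence and $k\ge 2$ an integer. (i) If $S\in\mathcal{S}(k)$, i.e. $2^{i-1}\le s_i<2^i$ for all $i\le k-1$ and $s_k<2^{k-1}$, then the path $P_n$ is $\chi_S$-critical if and only if $n\in\{2^0,2^1,\ldots,2^{k-1}\}$. (ii) If $2^{i-1}\le s_i<2^i$ holds for every entry $s_i$ of $S$, then $P_n$ is $\chi_S$-critical if and only if $n\in\{2^j : j\in\mathbb{N}_0\}$.
   Context: A packing sequence is a non-decreasing infinite sequence $S=(s_1,s_2,\ldots)$ of positive integers. For a graph $G$, a map $\phi\colon V(G)\to\{1,\ldots,k\}$ is an $S$-packing $k$-coloring if any two distinct vertices $u,v$ with $\phi(u)=\phi(v)=i$ satisfy $d_G(u,v) > s_i$; $\chi_S(G)$ is the least such $k$. A graph $G$ is $\chi_S$-critical if $\chi_S(H)<\chi_S(G)$ for every proper subgraph $H$ of $G$. $P_n$ denotes the path on $n\ge1$ vertices. For $k\ge2$, $\mathcal{S}(k)$ is the set of packing sequences with $2^{i-1}\le s_i<2^i$ for all $i\le k-1$ and $s_k<2^{k-1}$. -}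

module Defs where

open import Data.Nat using (ℕ; zero; suc; _+_; _∸_; _^_; _≤_; _<_)
open import Data.Fin using (Fin; toℕ)
open import Data.Bool using (Bool; true; false)
open import Data.Product using (Σ; _×_; _,_; ∃; ∃-syntax)
open import Data.Sum using (_⊎_; inj₁; inj₂)
import Data.Sum
open import Relation.Nullary using (¬_)
open import Relation.Binary.PropositionalEquality using (_≡_; _≢_)

-- A packing sequence s_1, s_2, ... is encoded as s : ℕ → ℕ, where  s i  is s_i
-- for i ≥ 1 (the value s 0 is irrelevant).
record IsPackingSeq (s : ℕ → ℕ) : Set where
  field
    positive    : ∀ i → 1 ≤ i → 1 ≤ s i
    nondecr     : ∀ i j → 1 ≤ i → i ≤ j → s i ≤ s j

record Graph : Set₁ where
  field
    n     : ℕ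
    E     : Fin n → Fin n → Set
    sym   : ∀ u v → E u v → E v u
    irr   : ∀ u → ¬ E u u

data Walk {V : Set} (E : V → V → Set) : V → V → ℕ → Set where
  nil  : ∀ {u} → Walk E u u 0
  cons : ∀ {u w v ℓ} → E u w → Walk E w v ℓ → Walk E u v (suc ℓ)

-- d(u,v) > d  :  every walk (hence every path) from u to v has length > d
-- (vacuous when u, v lie in different components, where d(u,v) = ∞).
DistGt : {V : Set} (E : V → V → Set) → V → V → ℕ → Set
DistGt E u v d = ∀ ℓ → Walk E u v ℓ → d < ℓ

-- S-packing k-coloring with colors Fin k; color c ∈ Fin k stands for the
-- color i = toℕ c + 1 ∈ {1,…,k}.
IsSPackingColoring : (s : ℕ → ℕ) {V : Set} (E : V → V → Set) (k : ℕ) → (V → Fin k) → Set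
IsSPackingColoring s E k φ =
  ∀ u v → u ≢ v → φ u ≡ φ v → DistGt E u v (s (suc (toℕ (φ u))))

SColorable : (s : ℕ → ℕ) {V : Set} (E : V → V → Set) (k : ℕ) → Set
SColorable s {V} E k = Σ (V → Fin k) (IsSPackingColoring s E k)

record Subgraph (G : Graph) : Set where
  open Graph G
  field
    inV      : Fin n → Bool
    inE      : Fin n → Fin n → Bool
    inE-sym  : ∀ u v → inE u v ≡ inE v u
    inE-E    : ∀ u v → inE u v ≡ true → E u v
    inE-endl : ∀ u v → inE u v ≡ true → inV u ≡ true
    inE-endr : ∀ u v → inE u v ≡ true → inV v ≡ true

  Vert : Set
  Vert = Σ (Fin n) (λ v → inV v ≡ true)

  Edge : Vert → Vert → Set
  Edge (u , _) (v , _) = inE u v ≡ true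

Proper : {G : Graph} → Subgraph G → Set
Proper {G} H =
  (∃[ v ] inV v ≡ false) ⊎ (∃[ u ] ∃[ v ] (E u v × inE u v ≡ false))
  where open Graph G
        open Subgraph H

-- χ_S(H) < χ_S(G)  written out as: some k has χ_S(H) ≤ k < χ_S(G),
-- i.e. H is S-packing k-colorable while G is not.
ChiLt : (s : ℕ → ℕ) (G : Graph) → Subgraph G → Set
ChiLt s G H = ∃[ k ] (SColorable s (Subgraph.Edge H) k × ¬ SColorable s (Graph.E G) k)

Critical : (s : ℕ → ℕ) → Graph → Set
Critical s G = ∀ (H : Subgraph G) → Proper H → ChiLt s G H

PathE : (n : ℕ) → Fin n → Fin n → Set
PathE n u v = (toℕ v ≡ suc (toℕ u)) ⊎ (toℕ u ≡ suc (toℕ v))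


private
  PathE-sym : ∀ n (u v : Fin n) → PathE n u v → PathE n v u
  PathE-sym n u v (Data.Sum.inj₁ p) = Data.Sum.inj₂ p
  PathE-sym n u v (Data.Sum.inj₂ p) = Data.Sum.inj₁ p

  n≢sn : ∀ m → ¬ (m ≡ suc m)
  n≢sn m ()

  PathE-irr : ∀ n (u : Fin n) → ¬ PathE n u u
  PathE-irr n u (Data.Sum.inj₁ p) = n≢sn (toℕ u) p
  PathE-irr n u (Data.Sum.inj₂ p) = n≢sn (toℕ u) p

P : ℕ → Graph
P n = record { n = n ; E = PathE n ; sym = PathE-sym n ; irr = PathE-irr n }

{-# OPTIONS --safe #-}
-- Color vertex p = 0, 1, … of a path with 1 + min(ν₂(p + 1), t), the 2-adic valuation of p + 1
-- truncated at t. Two vertices sharing a value c < t differ by a multiple of 2^(c+1) > s_{c+1};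
-- two vertices sharing the value t differ by a multiple of 2^t, which suffices when s_{t+1} < 2^t,
-- and cannot both exist on fewer than 2^(t+1) vertices. Conversely, if 2^(c-1) ≤ s_c for c ≤ m,
-- then any 2^m consecutive vertices contain one colored ≥ m + 1: by induction the first 2^(m-1)
-- of them contain a vertex u colored ≥ m, so do the 2^(m-1) vertices following u, and color m
-- cannot occur twice within distance 2^(m-1) ≤ s_m.
-- Hence P_{2^j} needs j + 1 colors, while a proper subgraph of it misses an edge or a vertex and so
-- lies in two disjoint shorter paths, which are j-colorable. If n is not a power of two (or, in the
-- bounded case, n > 2^(k-1)), P_n needs no more colors than P_{n-1}, which survives the deletion
-- of the last edge, so P_n is not critical.
module Submission where

open import Defs
open import Data.Bool using (true; false) renaming (_≟_ to _≟ᵇ_)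
open import Data.Bool.Properties using (not-¬)
open import Data.Empty using (⊥-elim)
open import Data.Fin using (Fin; toℕ; fromℕ<; inject₁; inject≤)
open import Data.Fin.Patterns using (0F)
open import Data.Fin.Properties
  using (toℕ-fromℕ<; toℕ-injective; toℕ<n; toℕ-inject₁; inject₁-injective; toℕ-inject≤; inject≤-injective)
open import Data.Nat
open import Data.Nat.Divisibility
open import Data.Nat.Properties
open import Data.Product using (∃-syntax; _×_; _,_; proj₁; proj₂)
open import Data.Sum using (_⊎_; inj₁; inj₂)
import Data.Sum as Sum
open import Function using (_∘_)
open import Function.Bundles using (_⇔_; mk⇔)
open import Relation.Binary.Definitions using (tri<; tri≈; tri>)
open import Relation.Binary.PropositionalEquality
open import Relation.Nullary using (¬_; Dec; does; yes; no; contradiction)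
open import Relation.Nullary.Decidable using (_×-dec_; _⊎-dec_; dec-true; dec-false; does-⇔)
open import Axiom.UniquenessOfIdentityProofs using (module Decidable⇒UIP)

2^-bracket : ∀ n → 1 ≤ n → ∃[ m ] (2 ^ m ≤ n × n < 2 ^ suc m)
2^-bracket (suc zero) _ = 0 , ≤-refl , s≤s (s≤s z≤n)
2^-bracket (suc (suc n)) _ with 2^-bracket (suc n) (s≤s z≤n)
... | m , lo , hi with m≤n⇒m<n∨m≡n hi
...   | inj₁ 2+n≤2^[1+m] = m , m≤n⇒m≤1+n lo , 2+n≤2^[1+m]
...   | inj₂ 2+n≡2^[1+m] = suc m , ≤-reflexive (sym 2+n≡2^[1+m]) ,
          subst (_< 2 ^ suc (suc m)) (sym 2+n≡2^[1+m]) (^-monoʳ-< 2 (s≤s (s≤s z≤n)) (n<1+n (suc m)))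

2∣n⊎2∣1+n : ∀ n → 2 ∣ n ⊎ 2 ∣ suc n
2∣n⊎2∣1+n zero = inj₁ (divides 0 refl)
2∣n⊎2∣1+n (suc n) with 2∣n⊎2∣1+n n
... | inj₁ 2∣n   = inj₂ (∣m∣n⇒∣m+n ∣-refl 2∣n)
... | inj₂ 2∣1+n = inj₁ 2∣1+n

∣n∸m : ∀ {d m n} → d ∣ m → d ∣ n → m ≤ n → d ∣ n ∸ m
∣n∸m d∣m d∣n m≤n = ∣m+n∣m⇒∣n (subst (_ ∣_) (sym (m+[n∸m]≡n m≤n)) d∣n) d∣m

divisor≤difference : ∀ {d m n} → d ∣ m → d ∣ n → m < n → d ≤ n ∸ m
divisor≤difference d∣m d∣n m<n = ∣⇒≤ {{>-nonZero (m<n⇒0<n∸m m<n)}} (∣n∸m d∣m d∣n (<⇒≤ m<n))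

2*divisor≤ : ∀ {d m n} → d ∣ m → d ∣ n → 0 < m → m < n → 2 * d ≤ n
2*divisor≤ {d} {m} {n} d∣m d∣n 0<m m<n = begin
  2 * d       ≡⟨ cong (d +_) (+-identityʳ d) ⟩
  d + d       ≤⟨ +-mono-≤ (∣⇒≤ {{>-nonZero 0<m}} d∣m) (divisor≤difference d∣m d∣n m<n) ⟩
  m + (n ∸ m) ≡⟨ m+[n∸m]≡n (<⇒≤ m<n) ⟩
  n           ∎
  where open ≤-Reasoning

odd-multiples-gap : ∀ d {a b} → ¬ 2 ∣ a → ¬ 2 ∣ b → a < b → 2 * d ≤ b * d ∸ a * d
odd-multiples-gap d {a} {b} a-odd b-odd a<b = begin
  2 * d         ≤⟨ *-monoˡ-≤ d 2≤b∸a ⟩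
  (b ∸ a) * d   ≡⟨ *-distribʳ-∸ d b a ⟩
  b * d ∸ a * d ∎
  where
  open ≤-Reasoning
  2+a≤b : 2 + a ≤ b
  2+a≤b with 2∣n⊎2∣1+n a | m≤n⇒m<n∨m≡n a<b
  ... | inj₁ 2∣a   | _             = contradiction 2∣a a-odd
  ... | inj₂ _     | inj₁ 1+a<b    = 1+a<b
  ... | inj₂ 2∣1+a | inj₂ refl     = contradiction 2∣1+a b-odd
  2≤b∸a : 2 ≤ b ∸ a
  2≤b∸a = subst (_≤ b ∸ a) (m+n∸n≡m 2 a) (∸-monoˡ-≤ a 2+a≤b)

valuation-gap : ∀ c {x y} → 2 ^ c ∣ x → 2 ^ c ∣ y → ¬ 2 ^ suc c ∣ x → ¬ 2 ^ suc c ∣ y →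
                x < y → 2 ^ suc c ≤ y ∸ x
valuation-gap c (divides a refl) (divides b refl) 2^[1+c]∤x 2^[1+c]∤y x<y =
  odd-multiples-gap (2 ^ c) (2^[1+c]∤x ∘ *-monoˡ-∣ (2 ^ c)) (2^[1+c]∤y ∘ *-monoˡ-∣ (2 ^ c))
                    (*-cancelʳ-< (2 ^ c) a b x<y)

ruler : ℕ → ℕ → ℕ
ruler zero    x = zero
ruler (suc t) x with 2 ^ suc t ∣? x
... | yes _ = suc t
... | no  _ = ruler t x

ruler≤ : ∀ t x → ruler t x ≤ t
ruler≤ zero    x = z≤n
ruler≤ (suc t) x with 2 ^ suc t ∣? x
... | yes _ = ≤-refl
... | no  _ = m≤n⇒m≤1+n (ruler≤ t x)

2^ruler∣ : ∀ t x → 2 ^ ruler t x ∣ x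
2^ruler∣ zero    x = 1∣ x
2^ruler∣ (suc t) x with 2 ^ suc t ∣? x
... | yes 2^[1+t]∣x = 2^[1+t]∣x
... | no  _         = 2^ruler∣ t x

ruler-maximal : ∀ t x → ruler t x < t → ¬ 2 ^ suc (ruler t x) ∣ x
ruler-maximal (suc t) x r<1+t with 2 ^ suc t ∣? x
... | yes _         = contradiction r<1+t (<-irrefl refl)
... | no  2^[1+t]∤x with m≤n⇒m<n∨m≡n (ruler≤ t x)
...   | inj₁ r<t  = ruler-maximal t x r<t
...   | inj₂ r≡t  = subst (λ c → ¬ 2 ^ suc c ∣ x) (sym r≡t) 2^[1+t]∤x

ruler-gap : ∀ t {x y} → ruler t x ≡ ruler t y → ruler t x < t → x < y → 2 ^ suc (ruler t x) ≤ y ∸ x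
ruler-gap t {x} {y} same r<t =
  valuation-gap (ruler t x) (2^ruler∣ t x) 2^r∣y (ruler-maximal t x r<t) 2^[1+r]∤y
  where
  2^r∣y : 2 ^ ruler t x ∣ y
  2^r∣y = subst (λ c → 2 ^ c ∣ y) (sym same) (2^ruler∣ t y)
  2^[1+r]∤y : ¬ 2 ^ suc (ruler t x) ∣ y
  2^[1+r]∤y = subst (λ c → ¬ 2 ^ suc c ∣ y) (sym same) (ruler-maximal t y (subst (_< t) same r<t))

ruler≡t⇒2^t∣ : ∀ {t x} → ruler t x ≡ t → 2 ^ t ∣ x
ruler≡t⇒2^t∣ {t} {x} r≡t = subst (λ c → 2 ^ c ∣ x) r≡t (2^ruler∣ t x)

DyadicUpperBound : (ℕ → ℕ) → ℕ → Set
DyadicUpperBound s t = ∀ {c} → c < t → s (suc c) < 2 ^ suc c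

DyadicLowerBound : (ℕ → ℕ) → ℕ → Set
DyadicLowerBound s t = ∀ {c} → c < t → 2 ^ c ≤ s (suc c)

DyadicUpTo : (ℕ → ℕ) → ℕ → Set
DyadicUpTo s t = ∀ i → 1 ≤ i → i ≤ t → 2 ^ (i ∸ 1) ≤ s i × s i < 2 ^ i

DyadicUpTo⇒lower : ∀ {s t} → DyadicUpTo s t → DyadicLowerBound s t
DyadicUpTo⇒lower bounds c<t = proj₁ (bounds _ (s≤s z≤n) c<t)

DyadicUpTo⇒upper : ∀ {s t} → DyadicUpTo s t → DyadicUpperBound s t
DyadicUpTo⇒upper bounds c<t = proj₂ (bounds _ (s≤s z≤n) c<t)

Sparse : (ℕ → ℕ) → ℕ → ℕ → ℕ → Set
Sparse f m a b = ∀ {i j} → a ≤ i → i < j → j < b → f i ≡ f j → f i < m → 2 ^ f i < j ∸ i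

Sparse-shrink : ∀ {f m a a′ b b′} → a ≤ a′ → b′ ≤ b → Sparse f (suc m) a b → Sparse f m a′ b′
Sparse-shrink a≤a′ b′≤b sparse a′≤i i<j j<b′ same fi<m =
  sparse (≤-trans a≤a′ a′≤i) i<j (<-≤-trans j<b′ b′≤b) same (m<n⇒m<1+n fi<m)

first-half≤ : ∀ a m → a + 2 ^ m ≤ a + 2 ^ suc m
first-half≤ a m = +-monoʳ-≤ a (^-monoʳ-≤ 2 (n≤1+n m))

second-half≤ : ∀ {a u} m → u < a + 2 ^ m → suc u + 2 ^ m ≤ a + 2 ^ suc m
second-half≤ {a} {u} m u<a+2^m = begin
  suc u + 2 ^ m         ≤⟨ +-monoˡ-≤ (2 ^ m) u<a+2^m ⟩
  a + 2 ^ m + 2 ^ m     ≡⟨ +-assoc a (2 ^ m) (2 ^ m) ⟩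
  a + (2 ^ m + 2 ^ m)   ≡⟨ cong (λ x → a + (2 ^ m + x)) (+-identityʳ (2 ^ m)) ⟨
  a + 2 ^ suc m         ∎
  where open ≤-Reasoning

sparse⇒large-value : ∀ m {f a} → Sparse f m a (a + 2 ^ m) → ∃[ i ] (a ≤ i × i < a + 2 ^ m × m ≤ f i)
sparse⇒large-value zero {a = a} _ = a , ≤-refl , m<m+n a z<s , z≤n
sparse⇒large-value (suc m) {f} {a} sparse
  with sparse⇒large-value m (Sparse-shrink ≤-refl (first-half≤ a m) sparse)
... | u , a≤u , u<a+2^m , m≤fu with m≤n⇒m<n∨m≡n m≤fu
...   | inj₁ m<fu = u , a≤u , <-≤-trans u<a+2^m (first-half≤ a m) , m<fu
...   | inj₂ m≡fu with sparse⇒large-value m (Sparse-shrink (m≤n⇒m≤1+n a≤u) (second-half≤ m u<a+2^m) sparse)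
...     | v , u<v , v<1+u+2^m , m≤fv with m≤n⇒m<n∨m≡n m≤fv
...       | inj₁ m<fv = v , ≤-trans a≤u (<⇒≤ u<v) , <-≤-trans v<1+u+2^m (second-half≤ m u<a+2^m) , m<fv
...       | inj₂ m≡fv = contradiction far (≤⇒≯ near)
  where
  near : v ∸ u ≤ 2 ^ m
  near = m≤n+o⇒m∸n≤o v u (s≤s⁻¹ v<1+u+2^m)
  far : 2 ^ m < v ∸ u
  far = subst (λ c → 2 ^ c < v ∸ u) (sym m≡fu)
          (sparse a≤u u<v (<-≤-trans v<1+u+2^m (second-half≤ m u<a+2^m)) (trans (sym m≡fu) m≡fv)
                  (s≤s (≤-reflexive (sym m≡fu))))

record PathLayout {V : Set} (E : V → V → Set) : Set where
  field
    component : V → ℕ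
    position  : V → ℕ
    edge      : ∀ {x y} → E x y → component x ≡ component y × ∣ position x - position y ∣ ≡ 1
    injective : ∀ {x y} → component x ≡ component y → position x ≡ position y → x ≡ y

  walk-length : ∀ {x y ℓ} → Walk E x y ℓ → component x ≡ component y × ∣ position x - position y ∣ ≤ ℓ
  walk-length {x} nil = refl , ≤-reflexive (∣n-n∣≡0 (position x))
  walk-length {x} {y} (cons {w = w} e walk) with edge e | walk-length walk
  ... | same , ∣x-w∣≡1 | same′ , ∣w-y∣≤ℓ = trans same same′ ,
    ≤-trans (∣-∣-triangle (position x) (position w) (position y))
            (subst (λ d → d + _ ≤ suc _) (sym ∣x-w∣≡1) (s≤s ∣w-y∣≤ℓ))

∣n-1+n∣≡1 : ∀ n → ∣ n - suc n ∣ ≡ 1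
∣n-1+n∣≡1 zero    = refl
∣n-1+n∣≡1 (suc n) = ∣n-1+n∣≡1 n

adjacent⇒∣-∣≡1 : ∀ {p q} → q ≡ suc p ⊎ p ≡ suc q → ∣ p - q ∣ ≡ 1
adjacent⇒∣-∣≡1 {p} (inj₁ refl) = ∣n-1+n∣≡1 p
adjacent⇒∣-∣≡1 {q = q} (inj₂ refl) = trans (∣-∣-comm (suc q) q) (∣n-1+n∣≡1 q)

P-layout : ∀ n → PathLayout (PathE n)
P-layout n = record
  { component = λ _ → 0
  ; position  = toℕ
  ; edge      = λ e → refl , adjacent⇒∣-∣≡1 e
  ; injective = λ _ → toℕ-injective
  }

clamp : ∀ n → ℕ → Fin (suc n)
clamp n i = fromℕ< (s≤s (m⊓n≤n i n))

toℕ-clamp : ∀ {n i} → i ≤ n → toℕ (clamp n i) ≡ i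
toℕ-clamp i≤n = trans (toℕ-fromℕ< _) (m≤n⇒m⊓n≡m i≤n)

P-walk : ∀ {n} d {i} → i + d ≤ n → Walk (PathE (suc n)) (clamp n i) (clamp n (i + d)) d
P-walk zero {i} _ rewrite +-identityʳ i = nil
P-walk {n} (suc d) {i} i+[1+d]≤n =
  subst (λ x → Walk (PathE (suc n)) (clamp n i) (clamp n x) (suc d)) (sym (+-suc i d))
        (cons step (P-walk d 1+i+d≤n))
  where
  1+i+d≤n : suc i + d ≤ n
  1+i+d≤n = subst (_≤ n) (+-suc i d) i+[1+d]≤n
  step : PathE (suc n) (clamp n i) (clamp n (suc i))
  step = inj₁ (trans (toℕ-clamp (m+n≤o⇒m≤o (suc i) 1+i+d≤n))
                     (cong suc (sym (toℕ-clamp (m+n≤o⇒m≤o i i+[1+d]≤n)))))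

InitialEdge : ∀ n → Fin (suc n) → Fin (suc n) → Set
InitialEdge n u v = PathE (suc n) u v × toℕ u < n × toℕ v < n

initialEdge? : ∀ n u v → Dec (InitialEdge n u v)
initialEdge? n u v =
  ((toℕ v ≟ suc (toℕ u)) ⊎-dec (toℕ u ≟ suc (toℕ v))) ×-dec (toℕ u <? n ×-dec toℕ v <? n)

InitialEdge-sym : ∀ {n u v} → InitialEdge n u v → InitialEdge n v u
InitialEdge-sym (e , u<n , v<n) = Sum.swap e , v<n , u<n

does⇒ : ∀ {A : Set} (a? : Dec A) → does a? ≡ true → A
does⇒ (yes a) _ = a

dropLastEdge : ∀ n → Subgraph (P (suc n))
dropLastEdge n = record
  { inV      = λ _ → true
  ; inE      = λ u v → does (initialEdge? n u v)
  ; inE-sym  = λ u v →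
      does-⇔ (mk⇔ InitialEdge-sym InitialEdge-sym) (initialEdge? n u v) (initialEdge? n v u)
  ; inE-E    = λ u v e → proj₁ (does⇒ (initialEdge? n u v) e)
  ; inE-endl = λ _ _ _ → refl
  ; inE-endr = λ _ _ _ → refl
  }

dropLastEdge-proper : ∀ m → Proper (dropLastEdge (suc m))
dropLastEdge-proper m = inj₂ (penultimate , last , last-edge , missing)
  where
  penultimate last : Fin (suc (suc m))
  penultimate = clamp (suc m) m
  last        = clamp (suc m) (suc m)
  last-edge : PathE (suc (suc m)) penultimate last
  last-edge = inj₁ (trans (toℕ-clamp ≤-refl) (cong suc (sym (toℕ-clamp (n≤1+n m)))))
  missing : does (initialEdge? (suc m) penultimate last) ≡ false
  missing = dec-false (initialEdge? (suc m) penultimate last)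
                      (λ (_ , _ , last<1+m) → <-irrefl (toℕ-clamp ≤-refl) last<1+m)

block : ℕ → ℕ → ℕ
block a p with p ≤? a
... | yes _ = 0
... | no  _ = 1

offset : ℕ → ℕ → ℕ
offset a p with p ≤? a
... | yes _ = p
... | no  _ = p ∸ suc a

block-offset-step : ∀ {a p q} → q ≡ suc p → p ≢ a →
                    block a p ≡ block a q × ∣ offset a p - offset a q ∣ ≡ 1
block-offset-step {a} {p} refl p≢a with p ≤? a | suc p ≤? a
... | yes _   | yes _     = refl , ∣n-1+n∣≡1 p
... | yes p≤a | no  1+p≰a = contradiction (≤-antisym p≤a (s≤s⁻¹ (≰⇒> 1+p≰a))) p≢a
... | no  p≰a | yes 1+p≤a = contradiction (≤-trans (n≤1+n p) 1+p≤a) p≰a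
... | no  p≰a | no  _     =
  refl , subst (λ x → ∣ p ∸ suc a - x ∣ ≡ 1) (sym (+-∸-assoc 1 (≰⇒> p≰a))) (∣n-1+n∣≡1 (p ∸ suc a))

block-offset-injective : ∀ {a p q} → block a p ≡ block a q → offset a p ≡ offset a q → p ≡ q
block-offset-injective {a} {p} {q} same-block same-offset with p ≤? a | q ≤? a
... | yes _   | yes _   = same-offset
... | yes _   | no  _   = contradiction same-block 0≢1+n
... | no  _   | yes _   = contradiction (sym same-block) 0≢1+n
... | no  p≰a | no  q≰a = ∸-cancelʳ-≡ (≰⇒> p≰a) (≰⇒> q≰a) same-offset

1+offset< : ∀ {a p N} → suc a < N → p < N → suc (offset a p) < N
1+offset< {a} {p} 1+a<N p<N with p ≤? a
... | yes p≤a = ≤-<-trans (s≤s p≤a) 1+a<N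
... | no  p≰a = ≤-<-trans (≤-trans (≤-reflexive (sym (+-∸-assoc 1 (≰⇒> p≰a)))) (m∸n≤m p a)) p<N

module _ {N : ℕ} (H : Subgraph (P N)) where
  open Subgraph H

  CutAt : ℕ → Set
  CutAt a = ∀ {x y} → inE x y ≡ true → toℕ x ≡ a → toℕ y ≢ suc a

  private
    edge-at : ∀ {x y u v} → toℕ x ≡ toℕ u → toℕ y ≡ toℕ v → inE x y ≡ true → inE u v ≡ true
    edge-at x≡u y≡v = subst₂ (λ x y → inE x y ≡ true) (toℕ-injective x≡u) (toℕ-injective y≡v)

  proper⇒cut : 1 < N → Proper H → ∃[ a ] (suc a < N × CutAt a)
  proper⇒cut 1<N (inj₁ (v , v∉H)) with toℕ v in v≡
  ... | zero  = 0 , 1<N , λ {x} e x≡0 _ →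
    not-¬ v∉H (subst (λ w → inV w ≡ true) (toℕ-injective (trans x≡0 (sym v≡))) (inE-endl x _ e))
  ... | suc a = a , subst (_< N) v≡ (toℕ<n v) , λ {_} {y} e _ y≡1+a →
    not-¬ v∉H (subst (λ w → inV w ≡ true) (toℕ-injective (trans y≡1+a (sym v≡))) (inE-endr _ y e))
  proper⇒cut _ (inj₂ (u , v , inj₁ v≡1+u , uv∉H)) = toℕ u , subst (_< N) v≡1+u (toℕ<n v) ,
    λ e x≡u y≡1+u → not-¬ uv∉H (edge-at x≡u (trans y≡1+u (sym v≡1+u)) e)
  proper⇒cut _ (inj₂ (u , v , inj₂ u≡1+v , uv∉H)) = toℕ v , subst (_< N) u≡1+v (toℕ<n u) ,
    λ e x≡v y≡1+v → not-¬ uv∉H (trans (inE-sym u v) (edge-at x≡v (trans y≡1+v (sym u≡1+v)) e))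

  cut-layout : ∀ {a} → CutAt a → PathLayout Edge
  cut-layout {a} cut = record
    { component = block a ∘ toℕ ∘ proj₁
    ; position  = offset a ∘ toℕ ∘ proj₁
    ; edge      = λ {x} {y} → uncut-edge {x} {y}
    ; injective = injective
    }
    where
    uncut-edge : ∀ {x y} → Edge x y → block a (toℕ (proj₁ x)) ≡ block a (toℕ (proj₁ y)) ×
                                ∣ offset a (toℕ (proj₁ x)) - offset a (toℕ (proj₁ y)) ∣ ≡ 1
    uncut-edge {u , _} {v , _} e with inE-E u v e
    ... | inj₁ v≡1+u = block-offset-step v≡1+u (λ u≡a → cut e u≡a (trans v≡1+u (cong suc u≡a)))
    ... | inj₂ u≡1+v
      with block-offset-step u≡1+v (λ v≡a → cut (trans (inE-sym v u) e) v≡a (trans u≡1+v (cong suc v≡a)))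
    ...   | same-block , ∣v-u∣≡1 =
      sym same-block , trans (∣-∣-comm (offset a (toℕ u)) (offset a (toℕ v))) ∣v-u∣≡1
    injective : ∀ {x y} → block a (toℕ (proj₁ x)) ≡ block a (toℕ (proj₁ y)) →
                offset a (toℕ (proj₁ x)) ≡ offset a (toℕ (proj₁ y)) → x ≡ y
    injective {u , u∈H} {v , v∈H} same-block same-offset
      with toℕ-injective (block-offset-injective same-block same-offset)
    ... | refl = cong (u ,_) (Decidable⇒UIP.≡-irrelevant _≟ᵇ_ u∈H v∈H)

  cut-layout-bounded : ∀ {a} (cut : CutAt a) → suc a < N →
                       ∀ v → suc (PathLayout.position (cut-layout cut) v) < N
  cut-layout-bounded cut 1+a<N (v , _) = 1+offset< 1+a<N (toℕ<n v)

P₁-proper⇒empty : (H : Subgraph (P 1)) → Proper H → ¬ Subgraph.Vert H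
P₁-proper⇒empty H (inj₁ (0F , v∉H)) (0F , v∈H) = not-¬ v∉H v∈H
P₁-proper⇒empty H (inj₂ (0F , 0F , e , _))   _ = Graph.irr (P 1) 0F e

module _ {s : ℕ → ℕ} where

  ruler-separated : ∀ {t p q} → DyadicUpperBound s t → s (suc t) < 2 ^ t ⊎ suc q < 2 ^ suc t →
                    p < q → ruler t (suc p) ≡ ruler t (suc q) → s (suc (ruler t (suc p))) < q ∸ p
  ruler-separated {t} {p} {q} upper top p<q same with m≤n⇒m<n∨m≡n (ruler≤ t (suc p))
  ... | inj₁ r<t = <-≤-trans (upper r<t) (ruler-gap t same r<t (s≤s p<q))
  ... | inj₂ r≡t = top-color top
    where
    2^t∣1+p : 2 ^ t ∣ suc p
    2^t∣1+p = ruler≡t⇒2^t∣ r≡t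
    2^t∣1+q : 2 ^ t ∣ suc q
    2^t∣1+q = ruler≡t⇒2^t∣ (trans (sym same) r≡t)
    top-color : s (suc t) < 2 ^ t ⊎ suc q < 2 ^ suc t → s (suc (ruler t (suc p))) < q ∸ p
    top-color (inj₁ s[1+t]<2^t) = subst (λ c → s (suc c) < q ∸ p) (sym r≡t)
      (<-≤-trans s[1+t]<2^t (divisor≤difference 2^t∣1+p 2^t∣1+q (s≤s p<q)))
    top-color (inj₂ 1+q<2^[1+t]) =
      contradiction (2*divisor≤ 2^t∣1+p 2^t∣1+q z<s (s≤s p<q)) (<⇒≱ 1+q<2^[1+t])

  module _ {V : Set} {E : V → V → Set} where

    SColorable-mono : ∀ {a b} → a ≤ b → SColorable s E a → SColorable s E b
    SColorable-mono a≤b (φ , valid) = φ′ , valid′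
      where
      φ′ : V → Fin _
      φ′ v = inject≤ (φ v) a≤b
      valid′ : IsSPackingColoring s E _ φ′
      valid′ u v u≢v same = subst (λ c → DistGt E u v (s (suc c))) (sym (toℕ-inject≤ (φ u) a≤b))
        (valid u v u≢v (inject≤-injective a≤b a≤b (φ u) (φ v) same))

    SColorable-empty : ∀ {k} → ¬ V → SColorable s E k
    SColorable-empty empty = ⊥-elim ∘ empty , λ u → ⊥-elim (empty u)

  module _ {V W : Set} {E : V → V → Set} {F : W → W → Set}
           (f : V → W) (f-edge : ∀ {x y} → E x y → F (f x) (f y)) where

    map-walk : ∀ {x y ℓ} → Walk E x y ℓ → Walk F (f x) (f y) ℓ
    map-walk nil          = nil
    map-walk (cons e walk) = cons (f-edge e) (map-walk walk)

    SColorable-pullback : ∀ {k} → (∀ {x y} → f x ≡ f y → x ≡ y) → SColorable s F k → SColorable s E k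
    SColorable-pullback f-injective (φ , valid) =
      φ ∘ f , λ u v u≢v same ℓ walk → valid (f u) (f v) (u≢v ∘ f-injective) same ℓ (map-walk walk)

  module _ {V : Set} {E : V → V → Set} (layout : PathLayout E) {t : ℕ}
           (upper : DyadicUpperBound s t)
           (top : s (suc t) < 2 ^ t ⊎ (∀ v → suc (PathLayout.position layout v) < 2 ^ suc t)) where
    open PathLayout layout

    rulerColoring : V → Fin (suc t)
    rulerColoring v = fromℕ< (s≤s (ruler≤ t (suc (position v))))

    toℕ-rulerColoring : ∀ v → toℕ (rulerColoring v) ≡ ruler t (suc (position v))
    toℕ-rulerColoring v = toℕ-fromℕ< _

    private
      top-at : ∀ v → s (suc t) < 2 ^ t ⊎ suc (position v) < 2 ^ suc t
      top-at v = Sum.map₂ (λ bound → bound v) top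

    ruler-distance : ∀ {u v} → u ≢ v → component u ≡ component v →
                     ruler t (suc (position u)) ≡ ruler t (suc (position v)) →
                     s (suc (ruler t (suc (position u)))) < ∣ position u - position v ∣
    ruler-distance {u} {v} u≢v same-component same-color with <-cmp (position u) (position v)
    ... | tri< pu<pv _ _ = subst (s _ <_) (sym (m≤n⇒∣m-n∣≡n∸m (<⇒≤ pu<pv)))
                             (ruler-separated upper (top-at v) pu<pv same-color)
    ... | tri≈ _ pu≡pv _ = contradiction (injective same-component pu≡pv) u≢v
    ... | tri> _ _ pv<pu = subst₂ (λ c d → s (suc c) < d) (sym same-color) (sym (m≤n⇒∣n-m∣≡n∸m (<⇒≤ pv<pu)))
                             (ruler-separated upper (top-at u) pv<pu (sym same-color))

    layout-colorable : SColorable s E (suc t)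
    layout-colorable = rulerColoring , valid
      where
      valid : IsSPackingColoring s E (suc t) rulerColoring
      valid u v u≢v same ℓ walk with walk-length walk
      ... | same-component , distance≤ℓ =
        subst (λ c → s (suc c) < ℓ) (sym (toℕ-rulerColoring u))
          (<-≤-trans (ruler-distance u≢v same-component same-color) distance≤ℓ)
        where
        same-color : ruler t (suc (position u)) ≡ ruler t (suc (position v))
        same-color = trans (sym (toℕ-rulerColoring u)) (trans (cong toℕ same) (toℕ-rulerColoring v))

  P-colorable : ∀ {t} n → DyadicUpperBound s t → s (suc t) < 2 ^ t ⊎ n < 2 ^ suc t →
                 SColorable s (PathE n) (suc t)
  P-colorable n upper top =
    layout-colorable (P-layout n) upper (Sum.map₂ (λ n<2^[1+t] v → ≤-<-trans (toℕ<n v) n<2^[1+t]) top)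

  χ-P-lower-bound : ∀ {k m n} → SColorable s (PathE n) k → DyadicLowerBound s m → 2 ^ m ≤ n → m < k
  χ-P-lower-bound {m = m} {zero} _ _ 2^m≤0 = contradiction 2^m≤0 (<⇒≱ (m^n>0 2 m))
  χ-P-lower-bound {k} {m} {suc n} (φ , valid) lower 2^m≤1+n with sparse⇒large-value m sparse
    where
    color : ℕ → ℕ
    color i = toℕ (φ (clamp n i))
    sparse : Sparse color m 0 (2 ^ m)
    sparse {i} {j} _ i<j j<2^m same c<m = ≤-<-trans (lower c<m)
      (valid (clamp n i) (clamp n j) clamp-i≢j (toℕ-injective same) (j ∸ i) walk)
      where
      j≤n : j ≤ n
      j≤n = s≤s⁻¹ (<-≤-trans j<2^m 2^m≤1+n)
      clamp-i≢j : clamp n i ≢ clamp n j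
      clamp-i≢j i≡j = <⇒≢ i<j (trans (sym (toℕ-clamp (≤-trans (<⇒≤ i<j) j≤n)))
                                     (trans (cong toℕ i≡j) (toℕ-clamp j≤n)))
      walk : Walk (PathE (suc n)) (clamp n i) (clamp n j) (j ∸ i)
      walk = subst (λ x → Walk (PathE (suc n)) (clamp n i) (clamp n x) (j ∸ i)) (m+[n∸m]≡n (<⇒≤ i<j))
                   (P-walk (j ∸ i) (subst (_≤ n) (sym (m+[n∸m]≡n (<⇒≤ i<j))) j≤n))
  ... | i , _ , _ , m≤color = ≤-<-trans m≤color (toℕ<n (φ (clamp n i)))

  χ-P≤χ-dropLastEdge : ∀ {k} m → SColorable s (Subgraph.Edge (dropLastEdge (suc m))) k →
                       SColorable s (PathE (suc m)) k
  χ-P≤χ-dropLastEdge m =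
    SColorable-pullback (λ v → inject₁ v , refl)
                        (λ {u} {v} e → dec-true (initialEdge? (suc m) (inject₁ u) (inject₁ v)) (initial e))
                        (inject₁-injective ∘ cong proj₁)
    where
    initial : ∀ {u v} → PathE (suc m) u v → InitialEdge (suc m) (inject₁ u) (inject₁ v)
    initial {u} {v} e rewrite toℕ-inject₁ u | toℕ-inject₁ v = e , toℕ<n u , toℕ<n v

  P-not-critical : ∀ {t n} → DyadicLowerBound s t → 2 ^ t < n → SColorable s (PathE n) (suc t) →
                   ¬ Critical s (P n)
  P-not-critical {t = t} {suc zero} _ 2^t<1 = contradiction (s≤s⁻¹ 2^t<1) (<⇒≱ (m^n>0 2 t))
  P-not-critical {t} {suc (suc m)} lower 2^t<n colorable critical
    with critical (dropLastEdge (suc m)) (dropLastEdge-proper m)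
  ... | k , H-colorable , ¬colorable =
    ¬colorable (SColorable-mono t<k colorable)
    where
    t<k : t < k
    t<k = χ-P-lower-bound (χ-P≤χ-dropLastEdge m H-colorable) lower (s≤s⁻¹ 2^t<n)

  proper-subgraph-colorable : ∀ j → DyadicUpperBound s j → (H : Subgraph (P (2 ^ j))) → Proper H →
                               SColorable s (Subgraph.Edge H) j
  proper-subgraph-colorable zero _ H proper = SColorable-empty (P₁-proper⇒empty H proper)
  proper-subgraph-colorable (suc t) upper H proper
    with proper⇒cut H (^-monoʳ-< 2 (s≤s (s≤s z≤n)) (z<s {t})) proper
  ... | a , 1+a<N , cut =
    layout-colorable (cut-layout H cut) (upper ∘ m<n⇒m<1+n) (inj₂ (cut-layout-bounded H cut 1+a<N))

  P-critical : ∀ j → DyadicLowerBound s j → DyadicUpperBound s j → Critical s (P (2 ^ j))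
  P-critical j lower upper H proper =
    j , proper-subgraph-colorable j upper H proper ,
    λ colorable → <-irrefl refl (χ-P-lower-bound colorable lower ≤-refl)

  P-critical⇒power : ∀ {m n} → DyadicLowerBound s m → DyadicUpperBound s m →
                     2 ^ m ≤ n → n < 2 ^ suc m → Critical s (P n) → n ≡ 2 ^ m
  P-critical⇒power {m} {n} lower upper 2^m≤n n<2^[1+m] critical with n ≟ 2 ^ m
  ... | yes n≡2^m = n≡2^m
  ... | no  n≢2^m = contradiction critical
    (P-not-critical lower (≤∧≢⇒< 2^m≤n (n≢2^m ∘ sym)) (P-colorable n upper (inj₂ n<2^[1+m])))

  dyadic-critical-paths : (∀ t → DyadicLowerBound s t) → (∀ t → DyadicUpperBound s t) →
                          ∀ n → 1 ≤ n → Critical s (P n) ⇔ (∃[ j ] n ≡ 2 ^ j)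
  dyadic-critical-paths lower upper n 1≤n = mk⇔ critical⇒power power⇒critical
    where
    critical⇒power : Critical s (P n) → ∃[ j ] n ≡ 2 ^ j
    critical⇒power critical with 2^-bracket n 1≤n
    ... | m , 2^m≤n , n<2^[1+m] = m , P-critical⇒power (lower m) (upper m) 2^m≤n n<2^[1+m] critical
    power⇒critical : ∃[ j ] n ≡ 2 ^ j → Critical s (P n)
    power⇒critical (j , n≡2^j) = subst (Critical s ∘ P) (sym n≡2^j) (P-critical j (lower j) (upper j))

  bounded-critical-paths : ∀ k → DyadicLowerBound s k → DyadicUpperBound s k → s (suc k) < 2 ^ k →
                           ∀ n → 1 ≤ n → Critical s (P n) ⇔ (∃[ j ] (j ≤ k × n ≡ 2 ^ j))
  bounded-critical-paths k lower upper top n 1≤n = mk⇔ critical⇒power power⇒critical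
    where
    lower≤ : ∀ {m} → m ≤ k → DyadicLowerBound s m
    lower≤ m≤k c<m = lower (<-≤-trans c<m m≤k)
    upper≤ : ∀ {m} → m ≤ k → DyadicUpperBound s m
    upper≤ m≤k c<m = upper (<-≤-trans c<m m≤k)
    critical⇒power : Critical s (P n) → ∃[ j ] (j ≤ k × n ≡ 2 ^ j)
    critical⇒power critical with 2^-bracket n 1≤n
    ... | m , 2^m≤n , n<2^[1+m] with m ≤? k
    ...   | yes m≤k = m , m≤k , P-critical⇒power (lower≤ m≤k) (upper≤ m≤k) 2^m≤n n<2^[1+m] critical
    ...   | no  m≰k = contradiction critical (P-not-critical lower 2^k<n (P-colorable n upper (inj₁ top)))
      where
      2^k<n : 2 ^ k < n
      2^k<n = <-≤-trans (^-monoʳ-< 2 (s≤s (s≤s z≤n)) (≰⇒> m≰k)) 2^m≤n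
    power⇒critical : ∃[ j ] (j ≤ k × n ≡ 2 ^ j) → Critical s (P n)
    power⇒critical (j , j≤k , n≡2^j) =
      subst (Critical s ∘ P) (sym n≡2^j) (P-critical j (lower≤ j≤k) (upper≤ j≤k))

theorem3p4 : (s : ℕ → ℕ) → IsPackingSeq s → s 1 ≡ 1 → (k : ℕ) → 2 ≤ k →
    ((∀ i → 1 ≤ i → i ≤ k ∸ 1 → (2 ^ (i ∸ 1) ≤ s i × s i < 2 ^ i)) →
     s k < 2 ^ (k ∸ 1) →
     ∀ n → 1 ≤ n → (Critical s (P n) ⇔ (∃[ j ] (j ≤ k ∸ 1 × n ≡ 2 ^ j))))
    ×
    ((∀ i → 1 ≤ i → (2 ^ (i ∸ 1) ≤ s i × s i < 2 ^ i)) →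
     ∀ n → 1 ≤ n → (Critical s (P n) ⇔ (∃[ j ] (n ≡ 2 ^ j))))
theorem3p4 s _ _ (suc k) _ =
  (λ bounds → bounded-critical-paths {s} k (DyadicUpTo⇒lower bounds) (DyadicUpTo⇒upper bounds)) ,
  (λ bounds → dyadic-critical-paths {s} (λ _ → DyadicUpTo⇒lower (λ i 1≤i _ → bounds i 1≤i))
                                        (λ _ → DyadicUpTo⇒upper (λ i 1≤i _ → bounds i 1≤i)))
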